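{- Let $q$ be a parameter and $S(x,q)=\sum_{n\ge0}S_n(q)x^n=\frac{1+qx-\sqrt{(1+qx)^2-4(1+q)x}}{2(1+q)x}$. Let $\mathcal{Z}_n$ be the set of $q$-small Schröder paths of length $2n$ whose first two steps are not $\mathbf{ud}$. Let $\mathcal{V}_n$ be the set of weighted Dyck paths of length $2n$ described in the context, with weight functions $\alpha(x)=x$, $\beta(x)=(q+1)(S(x,q)-1)$ and $\gamma(x)=(q+1)x(S(x,q)-1)$. Then there exists a (weight-preserving) bijection between $\mathcal{Z}_n$ and $\mathcal{V}_n$.
   Context: A $q$-large Schröder path of length $2n$ is a lattice path from $(0,0)$ to $(2n,0)$ never going below the $x$-axis, with up steps $\mathbf{u}=(1,1)$ and down steps $\mathbf{d}=(1,-1)$ of weight $1$ and horizontal steps $\mathbf{H}=(2,0)$ of weight $q$; its weight is the product of its step weights. A $q$-small Schröder path is a $q$-large Schröder path having no $\mathbf{H}$-step on the $x$-axis; $S_n(q)$ is the total weight of the $q$-small Schröder paths of length $2n$. A Dyck path of length $2n$ is a lattice path from $(0,0)$ to $(2n,0)$ with steps $\mathbf{u}$, $\mathbf{d}$ never going below the $x$-axis. A valley is an occurrence of $\mathbf{du}$; its level is the ordinate of the common point of its two steps. A pyramid is a consecutive section $\mathbf{u}^h\mathbf{d}^h$ ($h\ge1$ its height); it is maximal if it cannot be extended to $\mathbf{u}^{h+1}\mathbf{d}^{h+1}$; its altitude is the ordinate of the endpoint of its last $\mathbf{d}$-step. A Dyck path is primitive if it is nonempty and touches the $x$-axis only at its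 endpoints. Given weight functions $\alpha(x)=\sum_{k\ge1}\alpha_kx^k$, $\beta(x)=\sum_{k\ge1}\beta_kx^k$, $\gamma(x)=\sum_{k\ge1}\gamma_kx^k$, let $\mathcal{A}_n$ be the set of primitive Dyck paths $P$ of length $2n$ all of whose valleys lie at the same level, weighted by: $w(\mathbf{u}^n\mathbf{d}^n)=\gamma_n$, and for $P=\mathbf{u}^k\mathbf{u}^{i_1}\mathbf{d}^{i_1}\cdots\mathbf{u}^{i_r}\mathbf{d}^{i_r}\mathbf{d}^k$ ($k\ge1$, $r\ge2$, $i_j\ge1$), $w(P)=\beta_k\alpha_{i_1}\cdots\alpha_{i_r}$; only paths of nonzero weight are kept. $\mathcal{V}_n$ is the set of Dyck paths of length $2n$ that are concatenations of zero or more paths from $\bigcup_{s\ge1}\mathcal{A}_s$, weighted by the product of the weights of the factors (empty path: weight $1$). A bijection between sets of weighted paths whose weights are polynomials with nonnegative integer coefficients in the parameters is understood in the weight-preserving sense: each path is regarded as a collection of copies, one per monomial term counted with multiplicity, and the bijection matches these copies with equal monomial weights. -}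

module Defs where

open import Data.Nat using (ℕ; zero; suc; _+_; _*_)
open import Data.Bool using (Bool; true; false)
open import Data.Unit using (⊤; tt)
open import Data.Empty using (⊥)
open import Data.Product using (Σ; Σ-syntax; _×_; _,_; proj₁; proj₂)
open import Data.List using (List; []; _∷_; _++_; replicate; concatMap; foldr; map)
open import Relation.Binary.PropositionalEquality using (_≡_)

data Step : Set where
  U D H : Step     -- u = (1,1), d = (1,-1), H = (2,0)

stepLen : Step → ℕ
stepLen U = 1
stepLen D = 1
stepLen H = 2

len : List Step → ℕ
len []       = 0
len (s ∷ ss) = stepLen s + len ss

numH : List Step → ℕ
numH []       = 0
numH (H ∷ ss) = suc (numH ss)
numH (_ ∷ ss) = numH ss

-- SmallFrom h p : reading p from height h, the path ends at height 0,
-- never goes below the x-axis, and has no H-step on the x-axis.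
data SmallFrom : ℕ → List Step → Set where
  end  : SmallFrom 0 []
  up   : ∀ {h p} → SmallFrom (suc h) p → SmallFrom h (U ∷ p)
  down : ∀ {h p} → SmallFrom h p → SmallFrom (suc h) (D ∷ p)
  hor  : ∀ {h p} → SmallFrom (suc h) p → SmallFrom (suc h) (H ∷ p)

SmallSchroder : ℕ → List Step → Set
SmallSchroder n p = SmallFrom 0 p × (len p ≡ 2 * n)

firstUD : List Step → Bool
firstUD (U ∷ D ∷ _) = true
firstUD _           = false

-- Polynomials in q with nonnegative integer coefficients, represented as
-- their collections of monomial copies: a type of copies, each carrying
-- the exponent of q of its monomial (coefficient of q^e = number of
-- copies of degree e).

record WPoly : Set₁ where
  field
    Copy : Set
    deg  : Copy → ℕ
open WPoly public

0ₚ : WPoly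
0ₚ = record { Copy = ⊥ ; deg = λ () }

1ₚ : WPoly
1ₚ = record { Copy = ⊤ ; deg = λ _ → 0 }

qₚ : WPoly
qₚ = record { Copy = ⊤ ; deg = λ _ → 1 }

_+ₚ_ : WPoly → WPoly → WPoly
A +ₚ B = record { Copy = Σ Bool T ; deg = d }
  where
  T : Bool → Set
  T true  = Copy A
  T false = Copy B
  d : Σ Bool T → ℕ
  d (true  , a) = deg A a
  d (false , b) = deg B b

_*ₚ_ : WPoly → WPoly → WPoly
A *ₚ B = record { Copy = Copy A × Copy B
                ; deg  = λ c → deg A (proj₁ c) + deg B (proj₂ c) }

prodₚ : List WPoly → WPoly
prodₚ = foldr _*ₚ_ 1ₚ

Sₙ : ℕ → WPoly
Sₙ n = record { Copy = Σ[ p ∈ List Step ] SmallSchroder n p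
              ; deg  = λ c → numH (proj₁ c) }

-- coefficient of x^k in S(x,q) - 1
S-1 : ℕ → WPoly
S-1 zero    = 0ₚ
S-1 (suc k) = Sₙ (suc k)

-- weight functions (coefficient of x^k), k ≥ 1
-- α(x) = x
α : ℕ → WPoly
α 1 = 1ₚ
α _ = 0ₚ

β : ℕ → WPoly
β k = (qₚ +ₚ 1ₚ) *ₚ S-1 k

γ : ℕ → WPoly
γ zero    = 0ₚ
γ (suc k) = (qₚ +ₚ 1ₚ) *ₚ S-1 k

-- Shapes of paths in ⋃ A_s:
--   pyr m           : u^{m+1} d^{m+1}                       (weight γ_{m+1})
--   val a i j is    : u^{a+1} u^{i+1}d^{i+1} u^{j+1}d^{j+1} ⋯ d^{a+1}
--                     (k = a+1 ≥ 1, r = 2 + length is ≥ 2, all i_j ≥ 1)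
--                     (weight β_k α_{i_1} ⋯ α_{i_r})

data AShape : Set where
  pyr : ℕ → AShape
  val : ℕ → ℕ → ℕ → List ℕ → AShape

peak : ℕ → List Step
peak h = replicate h U ++ replicate h D

renderA : AShape → List Step
renderA (pyr m)        = peak (suc m)
renderA (val a i j is) =
  replicate (suc a) U ++ concatMap (λ t → peak (suc t)) (i ∷ j ∷ is) ++ replicate (suc a) D

weightA : AShape → WPoly
weightA (pyr m)        = γ (suc m)
weightA (val a i j is) = β (suc a) *ₚ prodₚ (map (λ t → α (suc t)) (i ∷ j ∷ is))

ZCopy : ℕ → Set
ZCopy n = Σ[ p ∈ List Step ] (SmallSchroder n p × firstUD p ≡ false)

degZ : ∀ {n} → ZCopy n → ℕ
degZ (p , _) = numH p

VCopy : ℕ → Set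
VCopy n = Σ[ p ∈ List Step ] Σ[ fs ∈ List AShape ]
            (concatMap renderA fs ≡ p) × (len p ≡ 2 * n) ×
            Copy (prodₚ (map weightA fs))

degV : ∀ {n} → VCopy n → ℕ
degV (p , fs , _ , _ , c) = deg (prodₚ (map weightA fs)) c

-- A small Schröder path is a sequence of primitive factors U l D with l a large path, so a
-- path of Z is a list of large paths that does not start with the empty one (the factor ud).
-- Cutting this list before every nonempty factor leaves blocks: a nonempty large path
-- followed by j ≥ 0 factors ud. A nonempty large path is a run of ground-level arches U a D,
-- either nonempty and closed by nothing or followed by an H-step and a large path l; moving l
-- in front of the arches gives a nonempty small path marked 1 or q, i.e. a copy of the
-- coefficient (q+1)(S−1). If that small path has semilength k+1, a block with j = 0 becomes the
-- pyramid u^{k+2}d^{k+2} of weight γ_{k+2}, a block with j ≥ 1 the path u^{k+1}(ud)^{j+1}d^{k+1}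
-- of weight β_{k+1}α_1^{j+1}; both have the length of the block, and the degree in q is
-- carried by the copy.

module Submission where

open import Defs
open import Data.Nat using (ℕ; zero; suc; _+_; _*_)
open import Data.Nat.Properties
  using (+-assoc; +-comm; +-suc; +-identityʳ; *-suc; *-cancelˡ-≡; suc-injective; ≡-irrelevant)
open import Data.Nat.Tactic.RingSolver using (solve-∀)
open import Data.Bool using (true; false)
import Data.Bool.Properties as Bool
open import Data.Unit using (tt)
open import Data.Maybe using (Maybe; just; nothing; maybe′)
open import Data.Product using (Σ; Σ-syntax; _×_; _,_; proj₁; proj₂)
open import Data.Product.Function.NonDependent.Propositional using (_×-↔_)
open import Data.List using (List; []; _∷_; _++_; replicate; concatMap; map; length)
open import Data.List.Properties using (length-replicate; ++-identityʳ)
open import Data.List.NonEmpty using (List⁺; _∷_; _∷⁺_; toList)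
open import Function.Base using (_∘_; case_of_)
open import Function.Bundles using (_↔_; Inverse; mk↔ₛ′)
open import Function.Construct.Composition using (_↔-∘_)
open import Function.Properties.Inverse using (↔-refl)
open import Relation.Nullary using (Irrelevant; contradiction)
open import Relation.Binary.PropositionalEquality
open import Axiom.UniquenessOfIdentityProofs using (module Decidable⇒UIP)

open Inverse using (to; from; strictlyInverseˡ; strictlyInverseʳ)

Σ-≡-irrelevant : ∀ {A : Set} {P : A → Set} → (∀ {a} → Irrelevant (P a)) →
                 {x y : Σ A P} → proj₁ x ≡ proj₁ y → x ≡ y
Σ-≡-irrelevant irr {a , p} {.a , p′} refl = cong (a ,_) (irr p p′)

fibre-↔ : ∀ {A B : Set} (f : A ↔ B) (μ : A → ℕ) (ν : B → ℕ) → (∀ a → ν (to f a) ≡ μ a) →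
          ∀ m → (Σ A λ a → μ a ≡ m) ↔ (Σ B λ b → ν b ≡ m)
fibre-↔ f μ ν ν∘f≡μ m = mk↔ₛ′
  (λ (a , e) → to f a , trans (ν∘f≡μ a) e)
  (λ (b , e) → from f b , trans (sym (ν∘f≡μ (from f b))) (trans (cong ν (strictlyInverseˡ f b)) e))
  (λ (b , _) → Σ-≡-irrelevant ≡-irrelevant (strictlyInverseˡ f b))
  (λ (a , _) → Σ-≡-irrelevant ≡-irrelevant (strictlyInverseʳ f a))

List↔prodₚ : ∀ {A B : Set} {w : A → WPoly} → (B ↔ Σ A λ a → Copy (w a)) →
             List B ↔ Σ (List A) λ as → Copy (prodₚ (map w as))
List↔prodₚ {A} {B} {w} f = mk↔ₛ′ unzipCopies zipCopies unzip-zip zip-unzip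
  where
  unzipCopies : List B → Σ (List A) λ as → Copy (prodₚ (map w as))
  unzipCopies []       = [] , tt
  unzipCopies (b ∷ bs) = let a , c = to f b ; as , cs = unzipCopies bs in a ∷ as , c , cs

  zipCopies : (Σ (List A) λ as → Copy (prodₚ (map w as))) → List B
  zipCopies ([]     , _)      = []
  zipCopies (a ∷ as , c , cs) = from f (a , c) ∷ zipCopies (as , cs)

  unzip-zip : ∀ x → unzipCopies (zipCopies x) ≡ x
  unzip-zip ([]     , tt)     = refl
  unzip-zip (a ∷ as , c , cs) =
    cong₂ (λ (a′ , c′) (as′ , cs′) → a′ ∷ as′ , c′ , cs′)
          (strictlyInverseˡ f (a , c)) (unzip-zip (as , cs))

  zip-unzip : ∀ bs → zipCopies (unzipCopies bs) ≡ bs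
  zip-unzip []       = refl
  zip-unzip (b ∷ bs) = cong₂ _∷_ (strictlyInverseʳ f b) (zip-unzip bs)

module Runs {A B : Set} (view : A ↔ Maybe B) where

  ε₀ : A
  ε₀ = from view nothing

  expand : List (B × ℕ) → List A
  expand []             = []
  expand ((b , j) ∷ rs) = from view (just b) ∷ replicate j ε₀ ++ expand rs

  consRun : Maybe B → ℕ × List (B × ℕ) → ℕ × List (B × ℕ)
  consRun nothing  (j , rs) = suc j , rs
  consRun (just b) (j , rs) = 0 , (b , j) ∷ rs

  runs : List A → ℕ × List (B × ℕ)
  runs []       = 0 , []
  runs (a ∷ as) = consRun (to view a) (runs as)

  expand-runs : ∀ as → replicate (proj₁ (runs as)) ε₀ ++ expand (proj₂ (runs as)) ≡ as
  expand-runs []       = refl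
  expand-runs (a ∷ as) with to view a | strictlyInverseʳ view a
  ... | nothing | ε₀≡a   = cong₂ _∷_ ε₀≡a (expand-runs as)
  ... | just b  | from≡a = cong₂ _∷_ from≡a (expand-runs as)

  runs-expand : ∀ j rs → runs (replicate j ε₀ ++ expand rs) ≡ (j , rs)
  runs-expand (suc j) rs             rewrite strictlyInverseˡ view nothing  | runs-expand j rs = refl
  runs-expand zero    []             = refl
  runs-expand zero    ((b , j) ∷ rs) rewrite strictlyInverseˡ view (just b) | runs-expand j rs = refl

  runs-leading : ∀ {a} as → a ≢ ε₀ → proj₁ (runs (a ∷ as)) ≡ 0
  runs-leading {a} as a≢ε₀ with to view a | strictlyInverseʳ view a
  ... | nothing | ε₀≡a = contradiction (sym ε₀≡a) a≢ε₀
  ... | just _  | _    = refl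

  just≢ε₀ : ∀ b → from view (just b) ≢ ε₀
  just≢ε₀ b eq with trans (sym (strictlyInverseˡ view (just b)))
                          (trans (cong (to view) eq) (strictlyInverseˡ view nothing))
  ... | ()

len-++ : ∀ xs ys → len (xs ++ ys) ≡ len xs + len ys
len-++ []       ys = refl
len-++ (s ∷ xs) ys = trans (cong (stepLen s +_) (len-++ xs ys)) (sym (+-assoc (stepLen s) (len xs) (len ys)))

numH-++ : ∀ xs ys → numH (xs ++ ys) ≡ numH xs + numH ys
numH-++ []       ys = refl
numH-++ (U ∷ xs) ys = numH-++ xs ys
numH-++ (D ∷ xs) ys = numH-++ xs ys
numH-++ (H ∷ xs) ys = cong suc (numH-++ xs ys)

len-replicate : ∀ n s → len (replicate n s) ≡ n * stepLen s
len-replicate zero    s = refl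
len-replicate (suc n) s = cong (stepLen s +_) (len-replicate n s)

len-wrap : ∀ n m → len (replicate n U ++ m ++ replicate n D) ≡ 2 * n + len m
len-wrap n m rewrite len-++ (replicate n U) (m ++ replicate n D) | len-++ m (replicate n D)
                   | len-replicate n U | len-replicate n D = arith n (len m)
  where
  arith : ∀ n l → n * 1 + (l + n * 1) ≡ 2 * n + l
  arith = solve-∀

data Large : Set where
  ε    : Large
  ─_   : Large → Large
  ⟨_⟩_ : Large → Large → Large

infixr 5 _▸_

_▸_ : Large → List Step → List Step
ε       ▸ k = k
─ l     ▸ k = H ∷ l ▸ k
⟨ a ⟩ b ▸ k = U ∷ a ▸ D ∷ b ▸ k

small : List Large → List Step
small []       = []
small (l ∷ ls) = U ∷ l ▸ D ∷ small ls

▸-++ : ∀ l k m → l ▸ (k ++ m) ≡ (l ▸ k) ++ m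
▸-++ ε         k m = refl
▸-++ (─ l)     k m = cong (H ∷_) (▸-++ l k m)
▸-++ (⟨ a ⟩ b) k m rewrite ▸-++ b k m = cong (U ∷_) (▸-++ a (D ∷ b ▸ k) m)

small-++ : ∀ ls ms → small (ls ++ ms) ≡ small ls ++ small ms
small-++ []       ms = refl
small-++ (l ∷ ls) ms rewrite small-++ ls ms = cong (U ∷_) (▸-++ l (D ∷ small ls) (small ms))

numH-small-∷ : ∀ l ls → numH (small (l ∷ ls)) ≡ numH (l ▸ []) + numH (small ls)
numH-small-∷ l ls = trans (cong numH (▸-++ l [] (D ∷ small ls))) (numH-++ (l ▸ []) _)

len-small-∷ : ∀ l ls → len (small (l ∷ ls)) ≡ suc (len (l ▸ []) + suc (len (small ls)))
len-small-∷ l ls = cong suc (trans (cong len (▸-++ l [] (D ∷ small ls))) (len-++ (l ▸ []) _))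

semilength : Large → ℕ
semilength ε         = 0
semilength (─ l)     = suc (semilength l)
semilength (⟨ a ⟩ b) = suc (semilength a + semilength b)

smallSemilength : List Large → ℕ
smallSemilength []       = 0
smallSemilength (l ∷ ls) = suc (semilength l + smallSemilength ls)

len-▸ : ∀ l k → len (l ▸ k) ≡ 2 * semilength l + len k
len-▸ ε         k = refl
len-▸ (─ l)     k rewrite len-▸ l k = arith (semilength l) (len k)
  where
  arith : ∀ s n → 2 + (2 * s + n) ≡ 2 * suc s + n
  arith = solve-∀
len-▸ (⟨ a ⟩ b) k rewrite len-▸ a (D ∷ b ▸ k) | len-▸ b k =
  arith (semilength a) (semilength b) (len k)
  where
  arith : ∀ s t n → 1 + (2 * s + (1 + (2 * t + n))) ≡ 2 * suc (s + t) + n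
  arith = solve-∀

len-small : ∀ ls → len (small ls) ≡ 2 * smallSemilength ls
len-small []       = refl
len-small (l ∷ ls) rewrite len-▸ l (D ∷ small ls) | len-small ls = arith (semilength l) (smallSemilength ls)
  where
  arith : ∀ s t → 1 + (2 * s + (1 + 2 * t)) ≡ 2 * suc (s + t)
  arith = solve-∀

len-small-εs : ∀ j → len (small (replicate j ε)) ≡ 2 * j
len-small-εs zero    = refl
len-small-εs (suc j) = trans (cong (2 +_) (len-small-εs j)) (sym (*-suc 2 j))

numH-small-εs : ∀ j → numH (small (replicate j ε)) ≡ 0
numH-small-εs zero    = refl
numH-small-εs (suc j) = numH-small-εs j

SmallFrom-irrelevant : ∀ {h p} → Irrelevant (SmallFrom h p)
SmallFrom-irrelevant end      end      = refl
SmallFrom-irrelevant (up a)   (up b)   = cong up (SmallFrom-irrelevant a b)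
SmallFrom-irrelevant (down a) (down b) = cong down (SmallFrom-irrelevant a b)
SmallFrom-irrelevant (hor a)  (hor b)  = cong hor (SmallFrom-irrelevant a b)

data Stack : ℕ → Set where
  ground : List Large → Stack 0
  _∷_    : ∀ {h} → Large → Stack h → Stack (suc h)

stackSteps : ∀ {h} → Stack h → List Step
stackSteps (ground ls) = small ls
stackSteps (l ∷ s)     = l ▸ D ∷ stackSteps s

pushU : ∀ {h} → Stack (suc h) → Stack h
pushU (l ∷ ground ls) = ground (l ∷ ls)
pushU (l ∷ m ∷ s)     = ⟨ l ⟩ m ∷ s

pushH : ∀ {h} → Stack (suc h) → Stack (suc h)
pushH (l ∷ s) = ─ l ∷ s

-- Factorises a path from height h as l₁ D ⋯ l_h D followed by a small path, suffix by suffix: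
-- an H extends the top large path, a U closes it into an arch in front of the next one.
parse : ∀ {h p} → SmallFrom h p → Stack h
parse end      = ground []
parse (up d)   = pushU (parse d)
parse (down d) = ε ∷ parse d
parse (hor d)  = pushH (parse d)

stackSteps-pushU : ∀ {h} (s : Stack (suc h)) → stackSteps (pushU s) ≡ U ∷ stackSteps s
stackSteps-pushU (l ∷ ground ls) = refl
stackSteps-pushU (l ∷ m ∷ s)     = refl

stackSteps-pushH : ∀ {h} (s : Stack (suc h)) → stackSteps (pushH s) ≡ H ∷ stackSteps s
stackSteps-pushH (l ∷ s) = refl

stackSteps-parse : ∀ {h p} (d : SmallFrom h p) → stackSteps (parse d) ≡ p
stackSteps-parse end      = refl
stackSteps-parse (up d)   = trans (stackSteps-pushU (parse d)) (cong (U ∷_) (stackSteps-parse d))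
stackSteps-parse (down d) = cong (D ∷_) (stackSteps-parse d)
stackSteps-parse (hor d)  = trans (stackSteps-pushH (parse d)) (cong (H ∷_) (stackSteps-parse d))

buildLarge : ∀ {h k} (l : Large) → SmallFrom (suc h) k → SmallFrom (suc h) (l ▸ k)
buildLarge ε         e = e
buildLarge (─ l)     e = hor (buildLarge l e)
buildLarge (⟨ a ⟩ b) e = up (buildLarge a (down (buildLarge b e)))

buildStack : ∀ {h} (s : Stack h) → SmallFrom h (stackSteps s)
buildStack (ground [])       = end
buildStack (ground (l ∷ ls)) = up (buildLarge l (down (buildStack (ground ls))))
buildStack (l ∷ s)           = buildLarge l (down (buildStack s))

pushLarge : ∀ {h} → Large → Stack (suc h) → Stack (suc h)
pushLarge ε         s = s
pushLarge (─ l)     s = pushH (pushLarge l s)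
pushLarge (⟨ a ⟩ b) s = pushU (pushLarge a (ε ∷ pushLarge b s))

pushLarge-ε : ∀ {h} l (s : Stack h) → pushLarge l (ε ∷ s) ≡ l ∷ s
pushLarge-ε ε         s = refl
pushLarge-ε (─ l)     s = cong pushH (pushLarge-ε l s)
pushLarge-ε (⟨ a ⟩ b) s rewrite pushLarge-ε b s | pushLarge-ε a (b ∷ s) = refl

parse-buildLarge : ∀ {h k} l (e : SmallFrom (suc h) k) → parse (buildLarge l e) ≡ pushLarge l (parse e)
parse-buildLarge ε         e = refl
parse-buildLarge (─ l)     e = cong pushH (parse-buildLarge l e)
parse-buildLarge (⟨ a ⟩ b) e rewrite parse-buildLarge a (down (buildLarge b e)) | parse-buildLarge b e = refl

parse-buildStack : ∀ {h} (s : Stack h) → parse (buildStack s) ≡ s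
parse-buildStack (ground [])       = refl
parse-buildStack (ground (l ∷ ls)) = cong pushU (begin
  parse (buildLarge l (down (buildStack (ground ls))))  ≡⟨ parse-buildLarge l _ ⟩
  pushLarge l (ε ∷ parse (buildStack (ground ls)))
    ≡⟨ cong (λ s → pushLarge l (ε ∷ s)) (parse-buildStack (ground ls)) ⟩
  pushLarge l (ε ∷ ground ls)                           ≡⟨ pushLarge-ε l (ground ls) ⟩
  l ∷ ground ls                                         ∎)
  where open ≡-Reasoning
parse-buildStack (l ∷ s) rewrite parse-buildLarge l (down (buildStack s)) | parse-buildStack s = pushLarge-ε l s

Q : Set
Q = Copy (qₚ +ₚ 1ₚ)

pattern q-copy   = true , tt
pattern one-copy = false , tt

arches : List Large → Large → Large
arches []       l = l
arches (a ∷ as) l = ⟨ a ⟩ arches as l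

fromView : Q × List⁺ Large → Large
fromView (q-copy   , l ∷ ls) = arches ls (─ l)
fromView (one-copy , ls)     = arches (toList ls) ε

consArch : Large → Maybe (Q × List⁺ Large) → Q × List⁺ Large
consArch a nothing                    = one-copy , a ∷ []
consArch a (just (one-copy , ls))     = one-copy , a ∷⁺ ls
consArch a (just (q-copy   , l ∷ ls)) = q-copy , l ∷ a ∷ ls

view : Large → Maybe (Q × List⁺ Large)
view ε         = nothing
view (─ l)     = just (q-copy , l ∷ [])
view (⟨ a ⟩ b) = just (consArch a (view b))

unview : Maybe (Q × List⁺ Large) → Large
unview = maybe′ fromView ε

view-fromView : ∀ x → view (fromView x) ≡ just x
view-fromView (q-copy , l ∷ ls) = view-arches-─ ls
  where
  view-arches-─ : ∀ ls → view (arches ls (─ l)) ≡ just (q-copy , l ∷ ls)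
  view-arches-─ []       = refl
  view-arches-─ (a ∷ as) rewrite view-arches-─ as = refl
view-fromView (one-copy , l ∷ ls) = view-arches-ε l ls
  where
  view-arches-ε : ∀ l ls → view (arches (l ∷ ls) ε) ≡ just (one-copy , l ∷ ls)
  view-arches-ε l []       = refl
  view-arches-ε l (a ∷ as) rewrite view-arches-ε a as = refl

unview-view : ∀ l → unview (view l) ≡ l
unview-view ε         = refl
unview-view (─ l)     = refl
unview-view (⟨ a ⟩ b) = trans (fromView-consArch (view b)) (cong (⟨ a ⟩_) (unview-view b))
  where
  fromView-consArch : ∀ m → fromView (consArch a m) ≡ ⟨ a ⟩ unview m
  fromView-consArch nothing                   = refl
  fromView-consArch (just (one-copy , _))     = refl
  fromView-consArch (just (q-copy   , _ ∷ _)) = refl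

Large↔Maybe : Large ↔ Maybe (Q × List⁺ Large)
Large↔Maybe = mk↔ₛ′ view unview view-unview unview-view
  where
  view-unview : ∀ m → view (unview m) ≡ m
  view-unview nothing  = refl
  view-unview (just x) = view-fromView x

▸-arches : ∀ as l k → arches as l ▸ k ≡ small as ++ l ▸ k
▸-arches []       l k = refl
▸-arches (a ∷ as) l k =
  cong (U ∷_) (trans (cong (λ m → a ▸ D ∷ m) (▸-arches as l k)) (▸-++ a (D ∷ small as) (l ▸ k)))

fromView-one : ∀ ls → fromView (one-copy , ls) ▸ [] ≡ small (toList ls)
fromView-one ls = trans (▸-arches (toList ls) ε []) (++-identityʳ _)

numH-fromView : ∀ c ls → numH (fromView (c , ls) ▸ []) ≡ deg (qₚ +ₚ 1ₚ) c + numH (small (toList ls))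
numH-fromView one-copy ls       = cong numH (fromView-one ls)
numH-fromView q-copy   (l ∷ ls) = begin
  numH (arches ls (─ l) ▸ [])             ≡⟨ cong numH (▸-arches ls (─ l) []) ⟩
  numH (small ls ++ H ∷ l ▸ [])           ≡⟨ numH-++ (small ls) _ ⟩
  numH (small ls) + suc (numH (l ▸ []))   ≡⟨ +-suc _ _ ⟩
  suc (numH (small ls) + numH (l ▸ []))   ≡⟨ cong suc (+-comm (numH (small ls)) _) ⟩
  suc (numH (l ▸ []) + numH (small ls))   ≡⟨ cong suc (sym (numH-small-∷ l ls)) ⟩
  suc (numH (small (l ∷ ls)))             ∎
  where open ≡-Reasoning

len-fromView : ∀ c ls → len (fromView (c , ls) ▸ []) ≡ len (small (toList ls))
len-fromView one-copy ls       = cong len (fromView-one ls)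
len-fromView q-copy   (l ∷ ls) = begin
  len (arches ls (─ l) ▸ [])                  ≡⟨ cong len (▸-arches ls (─ l) []) ⟩
  len (small ls ++ H ∷ l ▸ [])                ≡⟨ len-++ (small ls) _ ⟩
  len (small ls) + (2 + len (l ▸ []))         ≡⟨ arith (len (small ls)) (len (l ▸ [])) ⟩
  suc (len (l ▸ []) + suc (len (small ls)))   ≡⟨ sym (len-small-∷ l ls) ⟩
  len (small (l ∷ ls))                        ∎
  where
  open ≡-Reasoning
  arith : ∀ m n → m + (2 + n) ≡ suc (n + suc m)
  arith = solve-∀

Small⁺ : Set
Small⁺ = Σ ℕ λ k → Copy (Sₙ (suc k))

Small⁺-≡ : {x y : Small⁺} → proj₁ (proj₂ x) ≡ proj₁ (proj₂ y) → x ≡ y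
Small⁺-≡ {k , p , d , e} {k′ , .p , d′ , e′} refl
  with suc-injective (*-cancelˡ-≡ _ _ 2 (trans (sym e) e′))
... | refl = cong (λ de → k , p , de) (cong₂ _,_ (SmallFrom-irrelevant d d′) (≡-irrelevant e e′))

stack₁⁺ : Stack 1 → List⁺ Large
stack₁⁺ (l ∷ ground ls) = l ∷ ls

small-stack₁⁺ : ∀ s → small (toList (stack₁⁺ s)) ≡ U ∷ stackSteps s
small-stack₁⁺ (l ∷ ground ls) = refl

List⁺↔Small⁺ : List⁺ Large ↔ Small⁺
List⁺↔Small⁺ = mk↔ₛ′ toSmall⁺ fromSmall⁺ toSmall⁺-fromSmall⁺ fromSmall⁺-toSmall⁺
  where
  toSmall⁺ : List⁺ Large → Small⁺
  toSmall⁺ (l ∷ ls) =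
    semilength l + smallSemilength ls , small (l ∷ ls) , buildStack (ground (l ∷ ls)) , len-small (l ∷ ls)

  fromSmall⁺ : Small⁺ → List⁺ Large
  fromSmall⁺ (_ , _ , up e , _) = stack₁⁺ (parse e)
  fromSmall⁺ (_ , _ , end  , ())

  toSmall⁺-fromSmall⁺ : ∀ x → toSmall⁺ (fromSmall⁺ x) ≡ x
  toSmall⁺-fromSmall⁺ (_ , _ , up e , _) =
    Small⁺-≡ (trans (small-stack₁⁺ (parse e)) (cong (U ∷_) (stackSteps-parse e)))
  toSmall⁺-fromSmall⁺ (_ , _ , end  , ())

  fromSmall⁺-toSmall⁺ : ∀ ls → fromSmall⁺ (toSmall⁺ ls) ≡ ls
  fromSmall⁺-toSmall⁺ (l ∷ ls) = cong stack₁⁺ (parse-buildStack (l ∷ ground ls))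

open Runs Large↔Maybe using (expand; runs; expand-runs; runs-expand; runs-leading; just≢ε₀)

Block : Set
Block = (Q × List⁺ Large) × ℕ

blockLarges : Block → List Large
blockLarges (x , j) = fromView x ∷ replicate j ε

numH-block : ∀ c ls j →
             numH (small (blockLarges ((c , ls) , j))) ≡ deg (qₚ +ₚ 1ₚ) c + numH (small (toList ls))
numH-block c ls j = begin
  numH (small (fromView (c , ls) ∷ replicate j ε))               ≡⟨ numH-small-∷ (fromView (c , ls)) _ ⟩
  numH (fromView (c , ls) ▸ []) + numH (small (replicate j ε))
    ≡⟨ cong₂ _+_ (numH-fromView c ls) (numH-small-εs j) ⟩
  deg (qₚ +ₚ 1ₚ) c + numH (small (toList ls)) + 0                ≡⟨ +-identityʳ _ ⟩
  deg (qₚ +ₚ 1ₚ) c + numH (small (toList ls))                    ∎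
  where open ≡-Reasoning

len-block : ∀ c ls j →
            len (small (blockLarges ((c , ls) , j))) ≡ 2 * (2 + proj₁ (to List⁺↔Small⁺ ls) + j)
len-block c (l ∷ ls) j = begin
  len (small (fromView (c , l ∷ ls) ∷ replicate j ε))
    ≡⟨ len-small-∷ (fromView (c , l ∷ ls)) _ ⟩
  suc (len (fromView (c , l ∷ ls) ▸ []) + suc (len (small (replicate j ε))))
    ≡⟨ cong₂ (λ m n → suc (m + suc n))
             (trans (len-fromView c (l ∷ ls)) (len-small (l ∷ ls))) (len-small-εs j) ⟩
  suc (2 * suc k + suc (2 * j))                            ≡⟨ arith k j ⟩
  2 * (2 + k + j)                                          ∎
  where
  open ≡-Reasoning
  k = semilength l + smallSemilength ls
  arith : ∀ k j → suc (2 * suc k + suc (2 * j)) ≡ 2 * (2 + k + j)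
  arith = solve-∀

ZPath : Set
ZPath = Σ (List Step) λ p → SmallFrom 0 p × firstUD p ≡ false

ZPath-≡ : {x y : ZPath} → proj₁ x ≡ proj₁ y → x ≡ y
ZPath-≡ = Σ-≡-irrelevant λ (d , e) (d′ , e′) →
  cong₂ _,_ (SmallFrom-irrelevant d d′) (Decidable⇒UIP.≡-irrelevant Bool._≟_ e e′)

factors : Stack 0 → List Large
factors (ground ls) = ls

small-factors-parse : ∀ {p} (d : SmallFrom 0 p) → small (factors (parse d)) ≡ p
small-factors-parse d = trans (small-factors (parse d)) (stackSteps-parse d)
  where
  small-factors : ∀ s → small (factors s) ≡ stackSteps s
  small-factors (ground ls) = refl

firstUD-small : ∀ {l} ls → l ≢ ε → firstUD (small (l ∷ ls)) ≡ false
firstUD-small {ε}       _ l≢ε = contradiction refl l≢ε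
firstUD-small {─ _}     _ _   = refl
firstUD-small {⟨ _ ⟩ _} _ _   = refl

runs-leading-small : ∀ ls → firstUD (small ls) ≡ false → proj₁ (runs ls) ≡ 0
runs-leading-small []       _  = refl
runs-leading-small (l ∷ ls) ud = runs-leading {l} ls λ { refl → case ud of λ () }

ZPath↔Blocks : ZPath ↔ List Block
ZPath↔Blocks = mk↔ₛ′ toBlocks fromBlocks toBlocks-fromBlocks fromBlocks-toBlocks
  where
  toBlocks : ZPath → List Block
  toBlocks (_ , d , _) = proj₂ (runs (factors (parse d)))

  firstUD-expand : ∀ bs → firstUD (small (expand bs)) ≡ false
  firstUD-expand []            = refl
  firstUD-expand ((b , _) ∷ _) = firstUD-small _ (just≢ε₀ b)

  fromBlocks : List Block → ZPath
  fromBlocks bs = small (expand bs) , buildStack (ground (expand bs)) , firstUD-expand bs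

  toBlocks-fromBlocks : ∀ bs → toBlocks (fromBlocks bs) ≡ bs
  toBlocks-fromBlocks bs =
    trans (cong (proj₂ ∘ runs ∘ factors) (parse-buildStack (ground (expand bs))))
          (cong proj₂ (runs-expand 0 bs))

  fromBlocks-toBlocks : ∀ z → fromBlocks (toBlocks z) ≡ z
  fromBlocks-toBlocks (p , d , ud) = ZPath-≡ (begin
    small (expand rs)
      ≡⟨ cong (λ j → small (replicate j ε ++ expand rs)) (sym no-leading-ud) ⟩
    small (replicate j ε ++ expand rs)    ≡⟨ cong small (expand-runs ls) ⟩
    small ls                              ≡⟨ small-factors-parse d ⟩
    p                                     ∎)
    where
    open ≡-Reasoning
    ls = factors (parse d)
    j  = proj₁ (runs ls)
    rs = proj₂ (runs ls)
    no-leading-ud : j ≡ 0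
    no-leading-ud = runs-leading-small ls (trans (cong firstUD (small-factors-parse d)) ud)

HeightOnePeaks : Set
HeightOnePeaks = Σ (List ℕ) λ is → Copy (prodₚ (map (λ t → α (suc t)) is))

ℕ↔HeightOnePeaks : ℕ ↔ HeightOnePeaks
ℕ↔HeightOnePeaks = mk↔ₛ′ ones (λ (is , _) → length is) ones-length (λ j → length-replicate j)
  where
  units : ∀ j → Copy (prodₚ (map (λ t → α (suc t)) (replicate j 0)))
  units zero    = tt
  units (suc j) = tt , units j

  ones : ℕ → HeightOnePeaks
  ones j = replicate j 0 , units j

  ones-length : ∀ x → ones (length (proj₁ x)) ≡ x
  ones-length ([]        , tt)      = refl
  ones-length (zero ∷ is , tt , cs) =
    cong (λ (is′ , cs′) → 0 ∷ is′ , tt , cs′) (ones-length (is , cs))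
  ones-length (suc _ ∷ _ , () , _)

deg-HeightOnePeaks : ∀ ((is , cs) : HeightOnePeaks) → deg (prodₚ (map (λ t → α (suc t)) is)) cs ≡ 0
deg-HeightOnePeaks ([]        , tt)      = refl
deg-HeightOnePeaks (zero ∷ is , tt , cs) = deg-HeightOnePeaks (is , cs)
deg-HeightOnePeaks (suc _ ∷ _ , () , _)

len-HeightOnePeaks : ∀ ((is , _) : HeightOnePeaks) →
                     len (concatMap (λ t → peak (suc t)) is) ≡ 2 * length is
len-HeightOnePeaks ([]        , tt)      = refl
len-HeightOnePeaks (zero ∷ is , tt , cs) =
  trans (cong (2 +_) (len-HeightOnePeaks (is , cs))) (sym (*-suc 2 (length is)))
len-HeightOnePeaks (suc _ ∷ _ , () , _)

Factor : Set
Factor = Σ AShape λ f → Copy (weightA f)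

degFactor : Factor → ℕ
degFactor (f , c) = deg (weightA f) c

lenFactor : Factor → ℕ
lenFactor (f , _) = len (renderA f)

toFactor : (Q × Small⁺) × ℕ → Factor
toFactor ((c , k , p) , zero)  = pyr (suc k) , c , p
toFactor ((c , k , p) , suc j) = let is , cs = to ℕ↔HeightOnePeaks j in val k 0 0 is , (c , p) , tt , tt , cs

fromFactor : Factor → (Q × Small⁺) × ℕ
fromFactor (pyr zero    , _ , ())
fromFactor (pyr (suc k) , c , p) = (c , k , p) , zero
fromFactor (val k zero    zero    is , (c , p) , _ , _ , cs) =
  (c , k , p) , suc (from ℕ↔HeightOnePeaks (is , cs))
fromFactor (val _ (suc _) _       _  , _ , () , _)
fromFactor (val _ zero    (suc _) _  , _ , _ , () , _)

Q×Small⁺×ℕ↔Factor : ((Q × Small⁺) × ℕ) ↔ Factor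
Q×Small⁺×ℕ↔Factor = mk↔ₛ′ toFactor fromFactor toFactor-fromFactor fromFactor-toFactor
  where
  toFactor-fromFactor : ∀ f → toFactor (fromFactor f) ≡ f
  toFactor-fromFactor (pyr zero    , _ , ())
  toFactor-fromFactor (pyr (suc k) , c , p) = refl
  toFactor-fromFactor (val k zero zero is , (c , p) , _ , _ , cs) =
    cong (λ (is′ , cs′) → val k 0 0 is′ , (c , p) , tt , tt , cs′)
         (strictlyInverseˡ ℕ↔HeightOnePeaks (is , cs))
  toFactor-fromFactor (val _ (suc _) _       _  , _ , () , _)
  toFactor-fromFactor (val _ zero    (suc _) _  , _ , _ , () , _)

  fromFactor-toFactor : ∀ x → fromFactor (toFactor x) ≡ x
  fromFactor-toFactor (x , zero)  = refl
  fromFactor-toFactor (x , suc j) = cong (λ j′ → x , suc j′) (strictlyInverseʳ ℕ↔HeightOnePeaks j)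

deg-toFactor : ∀ c k p j → degFactor (toFactor ((c , k , p) , j)) ≡ deg (qₚ +ₚ 1ₚ) c + numH (proj₁ p)
deg-toFactor c k p zero    = refl
deg-toFactor c k p (suc j) =
  trans (cong (deg (qₚ +ₚ 1ₚ) c + numH (proj₁ p) +_) (deg-HeightOnePeaks (to ℕ↔HeightOnePeaks j)))
        (+-identityʳ _)

len-toFactor : ∀ c k p j → lenFactor (toFactor ((c , k , p) , j)) ≡ 2 * (2 + k + j)
len-toFactor c k p zero    = trans (len-wrap (2 + k) []) (arith k)
  where
  arith : ∀ k → 2 * (2 + k) + 0 ≡ 2 * (2 + k + 0)
  arith = solve-∀
len-toFactor c k p (suc j) = begin
  len (renderA (val k 0 0 is))                                   ≡⟨ len-wrap (suc k) _ ⟩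
  2 * suc k + len (concatMap (λ t → peak (suc t)) (0 ∷ 0 ∷ is))
    ≡⟨ cong (2 * suc k +_) (len-HeightOnePeaks (0 ∷ 0 ∷ is , tt , tt , cs)) ⟩
  2 * suc k + 2 * (2 + length is)
    ≡⟨ cong (λ l → 2 * suc k + 2 * (2 + l)) (strictlyInverseʳ ℕ↔HeightOnePeaks j) ⟩
  2 * suc k + 2 * (2 + j)                                        ≡⟨ arith k j ⟩
  2 * (2 + k + suc j)                                            ∎
  where
  open ≡-Reasoning
  is = proj₁ (to ℕ↔HeightOnePeaks j)
  cs = proj₂ (to ℕ↔HeightOnePeaks j)
  arith : ∀ k j → 2 * suc k + 2 * (2 + j) ≡ 2 * (2 + k + suc j)
  arith = solve-∀

Block↔Factor : Block ↔ Factor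
Block↔Factor = Q×Small⁺×ℕ↔Factor ↔-∘ ((↔-refl ×-↔ List⁺↔Small⁺) ×-↔ ↔-refl)

VPath : Set
VPath = Σ (List AShape) λ fs → Copy (prodₚ (map weightA fs))

degVPath : VPath → ℕ
degVPath (fs , c) = deg (prodₚ (map weightA fs)) c

lenVPath : VPath → ℕ
lenVPath (fs , _) = len (concatMap renderA fs)

Blocks↔VPath : List Block ↔ VPath
Blocks↔VPath = List↔prodₚ Block↔Factor

deg-Blocks↔VPath : ∀ bs → degVPath (to Blocks↔VPath bs) ≡ numH (small (expand bs))
deg-Blocks↔VPath []                     = refl
deg-Blocks↔VPath (b@((c , ls) , j) ∷ bs) = begin
  degFactor (to Block↔Factor b) + degVPath (to Blocks↔VPath bs)
    ≡⟨ cong₂ _+_ (trans (deg-toFactor c _ _ j) (sym (numH-block c ls j))) (deg-Blocks↔VPath bs) ⟩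
  numH (small (blockLarges b)) + numH (small (expand bs))   ≡⟨ sym (numH-++ (small (blockLarges b)) _) ⟩
  numH (small (blockLarges b) ++ small (expand bs))         ≡⟨ cong numH (sym (small-++ (blockLarges b) _)) ⟩
  numH (small (expand (b ∷ bs)))                            ∎
  where open ≡-Reasoning

len-Blocks↔VPath : ∀ bs → lenVPath (to Blocks↔VPath bs) ≡ len (small (expand bs))
len-Blocks↔VPath []                     = refl
len-Blocks↔VPath (b@((c , ls) , j) ∷ bs) = begin
  lenVPath (to Blocks↔VPath (b ∷ bs))                       ≡⟨ len-++ (renderA (proj₁ (to Block↔Factor b))) _ ⟩
  lenFactor (to Block↔Factor b) + lenVPath (to Blocks↔VPath bs)
    ≡⟨ cong₂ _+_ (trans (len-toFactor c _ _ j) (sym (len-block c ls j))) (len-Blocks↔VPath bs) ⟩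
  len (small (blockLarges b)) + len (small (expand bs))     ≡⟨ sym (len-++ (small (blockLarges b)) _) ⟩
  len (small (blockLarges b) ++ small (expand bs))          ≡⟨ cong len (sym (small-++ (blockLarges b) _)) ⟩
  len (small (expand (b ∷ bs)))                             ∎
  where open ≡-Reasoning

ZPath↔VPath : ZPath ↔ VPath
ZPath↔VPath = Blocks↔VPath ↔-∘ ZPath↔Blocks

deg-ZPath↔VPath : ∀ z → degVPath (to ZPath↔VPath z) ≡ numH (proj₁ z)
deg-ZPath↔VPath z =
  trans (deg-Blocks↔VPath (to ZPath↔Blocks z)) (cong (numH ∘ proj₁) (strictlyInverseʳ ZPath↔Blocks z))

len-ZPath↔VPath : ∀ z → lenVPath (to ZPath↔VPath z) ≡ len (proj₁ z)
len-ZPath↔VPath z =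
  trans (len-Blocks↔VPath (to ZPath↔Blocks z)) (cong (len ∘ proj₁) (strictlyInverseʳ ZPath↔Blocks z))

ZCopy↔ZPath : ∀ n → ZCopy n ↔ (Σ ZPath λ z → len (proj₁ z) ≡ 2 * n)
ZCopy↔ZPath n = mk↔ₛ′ (λ (p , (d , le) , ud) → (p , d , ud) , le)
                      (λ ((p , d , ud) , le) → p , (d , le) , ud)
                      (λ _ → refl) (λ _ → refl)

VPath↔VCopy : ∀ n → (Σ VPath λ v → lenVPath v ≡ 2 * n) ↔ VCopy n
VPath↔VCopy n = mk↔ₛ′ toVCopy fromVCopy (λ { (_ , _ , refl , _ , _) → refl }) (λ _ → refl)
  where
  toVCopy : (Σ VPath λ v → lenVPath v ≡ 2 * n) → VCopy n
  toVCopy ((fs , c) , le) = concatMap renderA fs , fs , refl , le , c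

  fromVCopy : VCopy n → Σ VPath λ v → lenVPath v ≡ 2 * n
  fromVCopy (_ , fs , refl , le , c) = (fs , c) , le

corollary3p6 : (n : ℕ) →
    Σ[ f ∈ ZCopy n ↔ VCopy n ] (∀ z → degV {n} (Inverse.to f z) ≡ degZ {n} z)
corollary3p6 n = ZCopy↔VCopy , λ (p , (d , _) , ud) → deg-ZPath↔VPath (p , d , ud)
  where
  ZCopy↔VCopy : ZCopy n ↔ VCopy n
  ZCopy↔VCopy = VPath↔VCopy n
            ↔-∘ (fibre-↔ ZPath↔VPath (len ∘ proj₁) lenVPath len-ZPath↔VPath (2 * n)
            ↔-∘ ZCopy↔ZPath n)
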